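{- Let $\mathscr{A}=(Q,\Sigma,\delta)$ be an aperiodically $1$-contracting DFA with state set $Q=\{q_1,\ldots,q_n\}$, and let $W=\{w_1,\ldots,w_n\}$ be a $1$-contracting collection with $w_i$ excluding $q_i$ and with $\sigma_W$ a cyclic permutation of $Q$. Define $\mathscr{S}_{k,i},\mathscr{T}_k,\mathscr{U}_{k,i}$ as in the context. Then for all $1\le i\le n$ and $1\le k\le n-1$, the map $S\mapsto\delta(S,w_i)$ is a bijection from $\mathscr{U}_{k-1,i}$ onto $\mathscr{S}_{k,i}$.
   Context: DFA $\mathscr{A}=(Q,\Sigma,\delta)$, transition function extended to words and to subsets by $\delta(S,w)=\{\delta(q,w)\mid q\in S\}$; $\delta^{ -1}(q,w)=\{p\in Q\mid\delta(p,w)=q\}$. A word $w$ is $1$-deficient excluding $q$ if $\delta(Q,w)=Q\setminus\{q\}$; then exactly one state $q^c$ has $|\delta^{ -1}(q^c,w)|=2$ (its contracting state). A $1$-contracting collection contains, for each $q\in Q$, exactly one $1$-deficient word excluding $q$; its state map $\sigma_W$ sends $q$ to the contracting state of that word. $\mathscr{A}$ is aperiodically $1$-contracting if some such $W$ has $\sigma_W$ a cyclic permutation (single $n$-cycle). Write $q_i^c=\sigma_W(q_i)$, the contracting state of $w_i$. Define $\mathscr{S}_{0,i}=\mathscr{T}_0=\mathscr{U}_{0,i}=\{Q\}$ for all $i$, and recursively for $k=1,\ldots,n-1$: $\mathscr{S}_{k,i}=\{\delta(S,w_i)\mid S\in\mathscr{U}_{k-1,i}\}$, $\mathscr{T}_k=\bigcup_{i=1}^n\mathscr{S}_{k,i}$,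 $\mathscr{U}_{k,i}=\{S\in\mathscr{T}_k\mid \delta^{ -1}(q_i^c,w_i)\subseteq S\}$. -}

module Defs where

open import Data.Nat using (ℕ; zero; suc)
open import Data.Fin using (Fin)
open import Data.Fin.Properties using (any?; _≟_)
open import Data.Fin.Subset using (Subset; _∈_; _⊆_; ⊤; _-_; ∣_∣)
open import Data.Fin.Subset.Properties using (_∈?_)
open import Data.List using (List; []; _∷_)
open import Data.Vec using (tabulate)
open import Data.Product using (Σ; ∃; _×_; _,_)
open import Relation.Nullary using (does)
open import Relation.Nullary.Decidable using (_×-dec_)
open import Relation.Binary.PropositionalEquality using (_≡_)
open import Function using (Bijective)

Trans : ℕ → ℕ → Set
Trans n m = Fin n → Fin m → Fin n

Word : ℕ → Set
Word m = List (Fin m)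

module _ {n m : ℕ} (δ : Trans n m) where

  δ* : Fin n → Word m → Fin n
  δ* p []      = p
  δ* p (a ∷ w) = δ* (δ p a) w

  -- δ(S, w) = { δ(p,w) | p ∈ S }
  image : Subset n → Word m → Subset n
  image S w = tabulate (λ q → does (any? (λ p → (p ∈? S) ×-dec (δ* p w ≟ q))))

  preimage : Fin n → Word m → Subset n
  preimage q w = tabulate (λ p → does (δ* p w ≟ q))

  OneDeficientExcluding : Word m → Fin n → Set
  OneDeficientExcluding w q = image ⊤ w ≡ ⊤ - q

  ContractingState : Word m → Fin n → Set
  ContractingState w c = ∣ preimage c w ∣ ≡ 2

  OneContractingCollection : (Fin n → Word m) → (Fin n → Fin n) → Set
  OneContractingCollection W σ =
    (∀ i → OneDeficientExcluding (W i) i) × (∀ i → ContractingState (W i) (σ i))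

iterate : {A : Set} → (A → A) → ℕ → A → A
iterate f zero    x = x
iterate f (suc k) x = f (iterate f k x)

IsCyclicPermutation : {n : ℕ} → (Fin n → Fin n) → Set
IsCyclicPermutation {n} σ = Bijective _≡_ _≡_ σ × (∀ p q → ∃ λ k → iterate σ k p ≡ q)

module Families {n m : ℕ} (δ : Trans n m) (W : Fin n → Word m) (σ : Fin n → Fin n) where

  mutual
    𝒮 : ℕ → Fin n → Subset n → Set
    𝒮 zero    i S = S ≡ ⊤
    𝒮 (suc k) i S = ∃ λ T → 𝒰 k i T × image δ T (W i) ≡ S

    𝒯 : ℕ → Subset n → Set
    𝒯 zero    S = S ≡ ⊤
    𝒯 (suc k) S = ∃ λ i → 𝒮 (suc k) i S

    𝒰 : ℕ → Fin n → Subset n → Set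
    𝒰 zero    i S = S ≡ ⊤
    𝒰 (suc k) i S = 𝒯 (suc k) S × preimage δ (σ i) (W i) ⊆ S

module Submission where

-- Write f = δ(·, wᵢ) and c = σ i for the contracting state of wᵢ.
-- The parts "maps into 𝒮_{k,i}" and "onto 𝒮_{k,i}" hold by the very definition
-- of 𝒮_{k,i} as the image of 𝒰_{k-1,i}; the content is injectivity.
--
--  * Counting: an endomap f of Fin n whose image contains Q ∖ {i} has at most
--    one value with two preimages.  Two distinct such values would yield an
--    injection Fin (n + 1) → Fin n (a right inverse of f on Q ∖ {i}, a second
--    preimage of the first collision value, and one of the other).
--  * Since δ(Q, wᵢ) = Q ∖ {qᵢ} and the fibre δ⁻¹(c, wᵢ) has two points,
--    δ(·, wᵢ) is injective off that fibre.
--  * So S ↦ δ(S, wᵢ) is injective on subsets containing δ⁻¹(c, wᵢ), and every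
--    member of 𝒰_{k-1,i} contains this fibre (for k = 1 it is Q itself).

open import Defs
open import Data.Nat using (ℕ; _≤_; _<_; pred; zero; suc; s≤s; z≤n)
open import Data.Nat.Properties using (n<1+n; ≤⇒≯)
open import Data.Fin using (Fin)
import Data.Fin as Fin
open import Data.Fin.Subset
  using (Subset; _∈_; _⊆_; ⊤; ∣_∣; ⁅_⁆)
open import Data.Fin.Subset.Properties
  using (_∈?_; ∈⊤; ⊆⊤; ⊆-antisym; nonempty?; Empty-unique; ∣⊥∣≡0; ∣⁅x⁆∣≡1;
         p⊆q⇒∣p∣≤∣q∣; x∈⁅x⁆; x∈p∧x≢y⇒x∈p-y)
open import Data.Fin.Properties using (any?; _≟_; <⇒notInjective)
open import Data.Bool using (true)
open import Data.Vec using (tabulate)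
open import Data.Vec.Properties using (lookup∘tabulate; []=⇒lookup; lookup⇒[]=)
open import Data.Product using (∃; _×_; _,_; proj₁; proj₂)
open import Data.Empty using (⊥-elim)
open import Data.Sum using (_⊎_; inj₁; inj₂)
open import Relation.Nullary using (Dec; yes; no; does; ¬?; contradiction)
open import Relation.Nullary.Decidable using (_×-dec_)
open import Relation.Binary.PropositionalEquality
  using (_≡_; _≢_; refl; sym; trans; cong; subst)
open import Function.Definitions using (Injective)

module _ {n : ℕ} {P : Fin n → Set} (P? : ∀ x → Dec (P x)) where

  ∈-tabulate⁻ : ∀ x → x ∈ tabulate (λ y → does (P? y)) → P x
  ∈-tabulate⁻ x x∈ with P? x | trans (sym (lookup∘tabulate (λ y → does (P? y)) x)) ([]=⇒lookup x∈)
  ... | yes px | _  = px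
  ... | no _   | ()

  ∈-tabulate⁺ : ∀ x → P x → x ∈ tabulate (λ y → does (P? y))
  ∈-tabulate⁺ x px =
    lookup⇒[]= x _ (trans (lookup∘tabulate (λ y → does (P? y)) x) (accepts (P? x)))
    where
    accepts : (d : Dec (P x)) → does d ≡ true
    accepts (yes _)   = refl
    accepts (no ¬px)  = contradiction px ¬px

distinct-pair : ∀ {n} (p : Subset n) → 2 ≤ ∣ p ∣ → ∃ λ a → ∃ λ b → a ≢ b × a ∈ p × b ∈ p
distinct-pair {n} p 2≤∣p∣ with nonempty? p
... | no empty = contradiction (subst (2 ≤_) ∣p∣≡0 2≤∣p∣) λ ()
  where
  ∣p∣≡0 : ∣ p ∣ ≡ 0
  ∣p∣≡0 = trans (cong ∣_∣ (Empty-unique empty)) (∣⊥∣≡0 n)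
... | yes (a , a∈p) with any? (λ b → (b ∈? p) ×-dec ¬? (a ≟ b))
...   | yes (b , b∈p , a≢b) = a , b , a≢b , a∈p , b∈p
...   | no no-other = contradiction 2≤∣p∣ (≤⇒≯ ∣p∣≤1)
  where
  p⊆⁅a⁆ : p ⊆ ⁅ a ⁆
  p⊆⁅a⁆ {x} x∈p with a ≟ x
  ... | yes refl = x∈⁅x⁆ a
  ... | no a≢x   = contradiction (x , x∈p , a≢x) no-other

  ∣p∣≤1 : ∣ p ∣ ≤ 1
  ∣p∣≤1 = subst (∣ p ∣ ≤_) (∣⁅x⁆∣≡1 a) (p⊆q⇒∣p∣≤∣q∣ p⊆⁅a⁆)

another : ∀ {n} {P : Fin n → Set} {u v : Fin n} → u ≢ v → P u → P v →
          ∀ t → ∃ λ r → P r × r ≢ t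
another {u = u} {v} u≢v pu pv t with u ≟ t
... | yes refl = v , pv , λ v≡u → u≢v (sym v≡u)
... | no u≢t   = u , pu , u≢t

-- Otherwise a right inverse of f on Q ∖ {i}, together
-- with a second preimage of each collision value, is an injection
-- Fin (n + 1) → Fin n.
module CoversAllButOne {n : ℕ} (f : Fin n → Fin n) (i : Fin n)
  (hits : ∀ x → x ≢ i → ∃ λ p → f p ≡ x) where

  s : Fin n → Fin n
  s x with x ≟ i
  ... | yes _   = x
  ... | no x≢i  = proj₁ (hits x x≢i)

  s-section : ∀ x → x ≢ i → f (s x) ≡ x
  s-section x x≢i with x ≟ i
  ... | yes x≡i  = contradiction x≡i x≢i
  ... | no x≢i′  = proj₂ (hits x x≢i′)

  at-most-one-collision : ∀ {a b p p′} → a ≢ b → f a ≡ f b → p ≢ p′ → f p ≡ f p′ →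
                          f p ≡ f a
  at-most-one-collision {a} {b} {p} {p′} a≢b fa≡fb p≢p′ fp≡fp′ with f p ≟ f a
  ... | yes fp≡fa = fp≡fa
  ... | no fp≢fa  = ⊥-elim (<⇒notInjective (n<1+n n) g-injective)
    where
    extra-a : ∃ λ a′ → f a′ ≡ f a × a′ ≢ s (f a)
    extra-a = another a≢b refl (sym fa≡fb) (s (f a))

    extra-p : ∃ λ r → f r ≡ f p × r ≢ s (f p)
    extra-p = another p≢p′ refl (sym fp≡fp′) (s (f p))

    r : Fin n
    r = proj₁ extra-p

    h-at : ∀ x → Dec (x ≡ i) → Fin n
    h-at x (yes _) = proj₁ extra-a
    h-at x (no _)  = s x

    h : Fin n → Fin n
    h x = h-at x (x ≟ i)

    HitsA HitsSelf : Fin n → Fin n → Set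
    HitsA x hx    = x ≡ i × f hx ≡ f a × hx ≢ s (f a)
    HitsSelf x hx = x ≢ i × f hx ≡ x × hx ≡ s x

    h-at-cases : ∀ x d → HitsA x (h-at x d) ⊎ HitsSelf x (h-at x d)
    h-at-cases x (yes x≡i) = inj₁ (x≡i , proj₂ extra-a)
    h-at-cases x (no x≢i)  = inj₂ (x≢i , s-section x x≢i , refl)

    h-cases : ∀ x → HitsA x (h x) ⊎ HitsSelf x (h x)
    h-cases x = h-at-cases x (x ≟ i)

    -- h i is distinct from every h y with y ≢ i: equal f-values force y ≡ f a
    mixed : ∀ {x y} → HitsA x (h x) → HitsSelf y (h y) → h x ≢ h y
    mixed {x} {y} (_ , fhx≡fa , hx≢sfa) (_ , fhy≡y , hy≡sy) hx≡hy =
      hx≢sfa (trans hx≡hy (trans hy≡sy (cong s y≡fa)))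
      where
      y≡fa : y ≡ f a
      y≡fa = trans (sym fhy≡y) (trans (cong f (sym hx≡hy)) fhx≡fa)

    h-injective : ∀ x y → h x ≡ h y → x ≡ y
    h-injective x y hx≡hy with h-cases x | h-cases y
    ... | inj₁ (x≡i , _)  | inj₁ (y≡i , _)  = trans x≡i (sym y≡i)
    ... | inj₁ hx         | inj₂ hy         = contradiction hx≡hy (mixed hx hy)
    ... | inj₂ hx         | inj₁ hy         = contradiction (sym hx≡hy) (mixed hy hx)
    ... | inj₂ (_ , fhx≡x , _) | inj₂ (_ , fhy≡y , _) =
      trans (sym fhx≡x) (trans (cong f hx≡hy) fhy≡y)

    -- r is not in the range of h: f r ≡ f p differs from f (h i) ≡ f a, and
    -- r ≡ h x with x ≢ i would force x ≡ f p, but r ≢ s (f p)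
    r-fresh : ∀ x → r ≢ h x
    r-fresh x r≡hx with h-cases x
    ... | inj₁ (_ , fhx≡fa , _) =
      fp≢fa (trans (sym (proj₁ (proj₂ extra-p))) (trans (cong f r≡hx) fhx≡fa))
    ... | inj₂ (_ , fhx≡x , hx≡sx) = proj₂ (proj₂ extra-p) (trans r≡hx (trans hx≡sx (cong s x≡fp)))
      where
      x≡fp : x ≡ f p
      x≡fp = trans (sym fhx≡x) (trans (cong f (sym r≡hx)) (proj₁ (proj₂ extra-p)))

    g : Fin (suc n) → Fin n
    g Fin.zero    = r
    g (Fin.suc x) = h x

    g-injective : Injective _≡_ _≡_ g
    g-injective {Fin.zero}  {Fin.zero}  _     = refl
    g-injective {Fin.zero}  {Fin.suc y} r≡hy  = contradiction r≡hy (r-fresh y)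
    g-injective {Fin.suc x} {Fin.zero}  hx≡r  = contradiction (sym hx≡r) (r-fresh x)
    g-injective {Fin.suc x} {Fin.suc y} hx≡hy = cong Fin.suc (h-injective x y hx≡hy)

module _ {n m : ℕ} (δ : Trans n m) (w : Word m) where

  ∈-image⁺ : ∀ {S p} → p ∈ S → δ* δ p w ∈ image δ S w
  ∈-image⁺ {S} {p} p∈S =
    ∈-tabulate⁺ (λ q → any? (λ p → (p ∈? S) ×-dec (δ* δ p w ≟ q))) _ (p , p∈S , refl)

  ∈-image⁻ : ∀ {S q} → q ∈ image δ S w → ∃ λ p → p ∈ S × δ* δ p w ≡ q
  ∈-image⁻ {S} {q} = ∈-tabulate⁻ (λ q → any? (λ p → (p ∈? S) ×-dec (δ* δ p w ≟ q))) q

  ∈-preimage⁺ : ∀ {c p} → δ* δ p w ≡ c → p ∈ preimage δ c w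
  ∈-preimage⁺ {c} = ∈-tabulate⁺ (λ p → δ* δ p w ≟ c) _

  ∈-preimage⁻ : ∀ {c p} → p ∈ preimage δ c w → δ* δ p w ≡ c
  ∈-preimage⁻ {c} = ∈-tabulate⁻ (λ p → δ* δ p w ≟ c) _

module OneDeficientWord {n m : ℕ} (δ : Trans n m) (w : Word m) (i c : Fin n)
  (deficient : OneDeficientExcluding δ w i) (contracting : ContractingState δ w c) where

  f : Fin n → Fin n
  f p = δ* δ p w

  hits : ∀ x → x ≢ i → ∃ λ p → f p ≡ x
  hits x x≢i with ∈-image⁻ δ w {⊤} (subst (x ∈_) (sym deficient) (x∈p∧x≢y⇒x∈p-y ∈⊤ x≢i))
  ... | p , _ , fp≡x = p , fp≡x

  contracted-pair : ∃ λ a → ∃ λ b → a ≢ b × f a ≡ c × f b ≡ c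
  contracted-pair with distinct-pair (preimage δ c w) (subst (2 ≤_) (sym contracting) (s≤s (s≤s z≤n)))
  ... | a , b , a≢b , a∈ , b∈ = a , b , a≢b , ∈-preimage⁻ δ w a∈ , ∈-preimage⁻ δ w b∈

  injective-off-fibre : ∀ {p p′} → f p ≡ f p′ → f p ≢ c → p ≡ p′
  injective-off-fibre {p} {p′} fp≡fp′ fp≢c with p ≟ p′
  ... | yes p≡p′ = p≡p′
  ... | no p≢p′  with contracted-pair
  ...   | a , b , a≢b , fa≡c , fb≡c = contradiction
            (trans (CoversAllButOne.at-most-one-collision f i hits a≢b (trans fa≡c (sym fb≡c)) p≢p′ fp≡fp′) fa≡c)
            fp≢c

  image-injective : ∀ S S′ → preimage δ c w ⊆ S → preimage δ c w ⊆ S′ →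
                    image δ S w ≡ image δ S′ w → S ≡ S′
  image-injective S S′ fibre⊆S fibre⊆S′ eq =
    ⊆-antisym (image-reflects-⊆ fibre⊆S′ eq) (image-reflects-⊆ fibre⊆S (sym eq))
    where
    -- a point of S outside the fibre is the unique preimage of its image
    image-reflects-⊆ : ∀ {S S′} → preimage δ c w ⊆ S′ → image δ S w ≡ image δ S′ w → S ⊆ S′
    image-reflects-⊆ {S} {S′} fibre⊆S′ eq {p} p∈S with f p ≟ c
    ... | yes fp≡c = fibre⊆S′ (∈-preimage⁺ δ w fp≡c)
    ... | no fp≢c with ∈-image⁻ δ w (subst (f p ∈_) eq (∈-image⁺ δ w p∈S))
    ...   | p′ , p′∈S′ , fp′≡fp = subst (_∈ S′) (sym (injective-off-fibre (sym fp′≡fp) fp≢c)) p′∈S′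

fibre⊆𝒰 : ∀ {n m} (δ : Trans n m) (W : Fin n → Word m) (σ : Fin n → Fin n) i k S →
          Families.𝒰 δ W σ k i S → preimage δ (σ i) (W i) ⊆ S
fibre⊆𝒰 δ W σ i zero    S refl         = ⊆⊤
fibre⊆𝒰 δ W σ i (suc k) S (_ , fibre⊆S) = fibre⊆S

-- The map S ↦ δ(S, wᵢ) from 𝒰_{k-1,i} to 𝒮_{k,i} is well defined and onto by
-- definition of 𝒮_{k,i}, and injective by image-injective.
lemma4 : {n m : ℕ} (δ : Trans n m) (W : Fin n → Word m) (σ : Fin n → Fin n)
    → OneContractingCollection δ W σ
    → IsCyclicPermutation σ
    → (i : Fin n) (k : ℕ) → 1 ≤ k → k < n
    → let open Families δ W σ in
    ((S : Subset n) → 𝒰 (pred k) i S → 𝒮 k i (image δ S (W i)))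
    × ((S S′ : Subset n) → 𝒰 (pred k) i S → 𝒰 (pred k) i S′
    → image δ S (W i) ≡ image δ S′ (W i) → S ≡ S′)
    × ((T : Subset n) → 𝒮 k i T → ∃ λ S → 𝒰 (pred k) i S × image δ S (W i) ≡ T)
lemma4 δ W σ (deficient , contracting) _ i (suc k) _ _ =
  into , injective , onto
  where
  open Families δ W σ
  open OneDeficientWord δ (W i) i (σ i) (deficient i) (contracting i)

  into : ∀ S → 𝒰 k i S → 𝒮 (suc k) i (image δ S (W i))
  into S S∈𝒰 = S , S∈𝒰 , refl

  injective : ∀ S S′ → 𝒰 k i S → 𝒰 k i S′ → image δ S (W i) ≡ image δ S′ (W i) → S ≡ S′
  injective S S′ S∈𝒰 S′∈𝒰 =
    image-injective S S′ (fibre⊆𝒰 δ W σ i k S S∈𝒰) (fibre⊆𝒰 δ W σ i k S′ S′∈𝒰)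

  onto : ∀ T → 𝒮 (suc k) i T → ∃ λ S → 𝒰 k i S × image δ S (W i) ≡ T
  onto T T∈𝒮 = T∈𝒮
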